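{- For $n\ge0$, $\mathrm{WI}_n=\sum_{k\ge0}2^kR_{n,k}$, where $\mathrm{WI}_n$ and $R_{n,k}$ are defined in the context.
   Context: For $n\ge1$, $S_n$ is the set of permutations of $\{0,\dots,n-1\}$ in one-line notation. $S^3_n$ is the set of pairs $\Pi=(\pi^2,\pi^3)$ of elements of $S_n$ (for $n=0$, the empty permutation); its elements are the columns $\Pi_j=(\pi^2_j,\pi^3_j)^T$ with level $\mathrm{lev}(\Pi_j)=\max\{\pi^2_j,\pi^3_j\}$. $\Pi$ is canonical if $\pi^2=01\cdots(n-1)$. $R_{n,k}$ is the number of canonical $\Pi\in S^3_n$ in which exactly $k$ distinct level values are each attained by two elements. $\mathrm{WI}_n$ is the number of $\Pi\in S^3_n$ with $\mathrm{lev}(\Pi_1)\le\mathrm{lev}(\Pi_2)\le\dots\le\mathrm{lev}(\Pi_n)$. -}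

module Defs where

open import Data.Nat using (ℕ; zero; suc; _+_; _*_; _^_; _≤_; _⊔_)
import Data.Nat as ℕ
open import Data.Fin using (Fin; toℕ)
import Data.Fin as F
open import Data.Vec using (Vec; lookup; tabulate)
open import Data.List using (List; length; filter; map; upTo; allFin)
open import Data.Nat.ListAction using (sum)
open import Data.Product using (_×_; proj₁; proj₂)
open import Data.Refinement using (Refinement; Refinement-syntax)
open import Relation.Binary.PropositionalEquality using (_≡_)

-- The distinctness
-- proof is irrelevant, so two permutations are equal iff their words are.
Perm : ℕ → Set
Perm n = [ w ∈ Vec (Fin n) n ∣ (∀ (i j : Fin n) → lookup w i ≡ lookup w j → i ≡ j) ]

idWord : (n : ℕ) → Vec (Fin n) n
idWord n = tabulate (λ i → i)

S3 : ℕ → Set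
S3 n = Perm n × Perm n

π² π³ : ∀ {n} → S3 n → Vec (Fin n) n
π² Π = Refinement.value (proj₁ Π)
π³ Π = Refinement.value (proj₂ Π)

lev : ∀ {n} → S3 n → Fin n → ℕ
lev Π j = toℕ (lookup (π² Π) j) ⊔ toℕ (lookup (π³ Π) j)

WeaklyIncreasing : ∀ {n} → S3 n → Set
WeaklyIncreasing {n} Π = ∀ (i j : Fin n) → i F.≤ j → lev Π i ≤ lev Π j

Canonical : ∀ {n} → S3 n → Set
Canonical {n} Π = π² Π ≡ idWord n

colsAtLevel : ∀ {n} → S3 n → ℕ → ℕ
colsAtLevel {n} Π ℓ = length (filter (λ j → lev Π j ℕ.≟ ℓ) (allFin n))

-- number of distinct level values (necessarily in {0,…,n-1})
-- attained by two elements (columns)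
doubledLevels : ∀ {n} → S3 n → ℕ
doubledLevels {n} Π = length (filter (λ ℓ → colsAtLevel Π ℓ ℕ.≟ 2) (upTo n))

WISet : ℕ → Set
WISet n = [ Π ∈ S3 n ∣ WeaklyIncreasing Π ]

RSet : ℕ → ℕ → Set
RSet n k = [ Π ∈ S3 n ∣ (Canonical Π × doubledLevels Π ≡ k) ]

sumTo : ℕ → (ℕ → ℕ) → ℕ
sumTo n f = sum (map f (upTo (suc n)))

-- Write a pair as Π = (τ , σ ∘ τ).  Column i of Π has level ℓ(τ i), where
-- ℓ(a) = max(a, σ a) is the level function of the canonical pair (id , σ);
-- so Π is weakly increasing iff τ lists {0,…,n-1} in weakly increasing
-- order of ℓ.  A level value v is attained at most twice: by its top v
-- (when σ v ≤ v) and by the partner σ⁻¹ v (when σ⁻¹ v < v).  Choosing,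
-- independently for each of the k doubled levels, which of the two comes
-- first determines a unique ordering: sort by the injective key
-- 2 ℓ(a) + (tie-break bit).  Hence σ contributes 2^k pairs to WI_n, and
-- grouping the σ by k gives Σ_k 2^k R_{n,k}.

module Submission where

open import Defs
open import Data.Nat using (ℕ; _*_; _^_)
open import Data.Fin using (Fin)
open import Function.Bundles using (_↔_; mk↔ₛ′)
open import Relation.Binary.PropositionalEquality using (_≡_)

open import Axiom.UniquenessOfIdentityProofs using (module Decidable⇒UIP)
open import Data.Bool using (Bool; true; false; if_then_else_; not)
open import Data.Empty using (⊥-elim-irr)
open import Data.Fin as F using (toℕ)
open import Data.Fin.Permutation using (↔⇒≡)
import Data.Fin.Properties as F
open import Data.Irrelevant using ([_])
open import Data.List as List using (length; filter; applyUpTo)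
open import Data.Nat as ℕ using (zero; suc; _+_; _∸_; _⊔_; _≤_; _<_; z≤n; s≤s)
open import Data.Nat.ListAction using (sum)
import Data.Nat.Properties as ℕ
open import Data.Product using (Σ; ∃; _×_; _,_; proj₁; proj₂)
open import Data.Product.Function.Dependent.Propositional using (Σ-↔)
open import Data.Product.Function.NonDependent.Propositional using (_×-↔_)
open import Data.Refinement using (Refinement-syntax; _,_; value; value-injective)
open import Data.Sum using (_⊎_; inj₁; inj₂)
open import Data.Sum.Function.Propositional using (_⊎-↔_)
open import Data.Vec as Vec using (Vec; lookup; tabulate)
import Data.Vec.Properties as Vec
open import Function.Base using (_∘_; id)
open import Function.Definitions using (Injective)
open import Function.Properties.Inverse using (↔-refl; ↔-sym; ↔-trans)
open import Function.Related.Propositional using (module EquationalReasoning; ≡⇒)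
open import Level using (0ℓ)
open import Relation.Binary.Core using (_Preserves_⟶_)
open import Relation.Binary.Definitions using (tri<; tri≈; tri>)
open import Relation.Binary.PropositionalEquality
  using (refl; sym; trans; cong; cong₂; subst; subst₂; _≢_; ≢-sym; module ≡-Reasoning)
open import Relation.Nullary using (¬_; Dec; yes; no; does; contradiction; _×-dec_)
open import Relation.Nullary.Decidable using (recompute; dec-true; dec-false)
open import Relation.Unary using (Pred; Decidable; _⊆_)
open import Relation.Unary.Properties using (U?; _∪?_)

private
  variable
    n : ℕ

does-true : ∀ {a} {A : Set a} (a? : Dec A) → does a? ≡ true → A
does-true (yes a) _ = a

count : ∀ {n p} {P : Pred (Fin n) p} → Decidable P → ℕ
count {zero}  P? = 0
count {suc n} P? = if does (P? F.zero) then suc (count (P? ∘ F.suc)) else count (P? ∘ F.suc)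

count-mono : ∀ {n p q} {P : Pred (Fin n) p} {Q : Pred (Fin n) q}
             (P? : Decidable P) (Q? : Decidable Q) → P ⊆ Q → count P? ≤ count Q?
count-mono {zero}  P? Q? P⊆Q = z≤n
count-mono {suc n} P? Q? P⊆Q with P? F.zero | Q? F.zero
... | yes _ | yes _ = s≤s (count-mono (P? ∘ F.suc) (Q? ∘ F.suc) P⊆Q)
... | yes p | no ¬q = contradiction (P⊆Q p) ¬q
... | no _  | yes _ = ℕ.m≤n⇒m≤1+n (count-mono (P? ∘ F.suc) (Q? ∘ F.suc) P⊆Q)
... | no _  | no _  = count-mono (P? ∘ F.suc) (Q? ∘ F.suc) P⊆Q

count-mono-< : ∀ {n p q} {P : Pred (Fin n) p} {Q : Pred (Fin n) q}
               (P? : Decidable P) (Q? : Decidable Q) → P ⊆ Q →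
               ∀ {a} → ¬ P a → Q a → count P? < count Q?
count-mono-< {suc n} P? Q? P⊆Q {F.zero} ¬p₀ q₀ with P? F.zero | Q? F.zero
... | yes p₀ | _      = contradiction p₀ ¬p₀
... | no _   | no ¬q₀ = contradiction q₀ ¬q₀
... | no _   | yes _  = s≤s (count-mono (P? ∘ F.suc) (Q? ∘ F.suc) P⊆Q)
count-mono-< {suc n} P? Q? P⊆Q {F.suc a} ¬pa qa with P? F.zero | Q? F.zero
... | yes p₀ | no ¬q₀ = contradiction (P⊆Q p₀) ¬q₀
... | yes _  | yes _  = s≤s (count-mono-< (P? ∘ F.suc) (Q? ∘ F.suc) P⊆Q ¬pa qa)
... | no _   | yes _  = ℕ.m<n⇒m<1+n (count-mono-< (P? ∘ F.suc) (Q? ∘ F.suc) P⊆Q ¬pa qa)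
... | no _   | no _   = count-mono-< (P? ∘ F.suc) (Q? ∘ F.suc) P⊆Q ¬pa qa

count-U : ∀ n → count (U? {A = Fin n}) ≡ n
count-U zero    = refl
count-U (suc n) = cong suc (count-U n)

count≤n : ∀ {n p} {P : Pred (Fin n) p} (P? : Decidable P) → count P? ≤ n
count≤n {n} P? = ℕ.≤-trans (count-mono P? U? _) (ℕ.≤-reflexive (count-U n))

count<n : ∀ {n p} {P : Pred (Fin n) p} (P? : Decidable P) {a} → ¬ P a → count P? < n
count<n {n} P? ¬pa = ℕ.<-≤-trans (count-mono-< P? U? _ ¬pa _) (ℕ.≤-reflexive (count-U n))

count-∪ : ∀ {n p q} {P : Pred (Fin n) p} {Q : Pred (Fin n) q}
          (P? : Decidable P) (Q? : Decidable Q) → count (P? ∪? Q?) ≤ count P? + count Q?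
count-∪ {zero}  P? Q? = z≤n
count-∪ {suc n} P? Q? with P? F.zero | Q? F.zero | count-∪ (P? ∘ F.suc) (Q? ∘ F.suc)
... | yes _ | yes _ | ih = s≤s (ℕ.≤-trans ih (ℕ.+-monoʳ-≤ _ (ℕ.n≤1+n _)))
... | yes _ | no _  | ih = s≤s ih
... | no _  | yes _ | ih = ℕ.≤-trans (s≤s ih) (ℕ.≤-reflexive (sym (ℕ.+-suc _ _)))
... | no _  | no _  | ih = ih

count-cong : ∀ {n p q} {P : Pred (Fin n) p} {Q : Pred (Fin n) q}
             (P? : Decidable P) (Q? : Decidable Q) → P ⊆ Q → Q ⊆ P → count P? ≡ count Q?
count-cong P? Q? P⊆Q Q⊆P = ℕ.≤-antisym (count-mono P? Q? P⊆Q) (count-mono Q? P? Q⊆P)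

count-∅ : ∀ {n p} {P : Pred (Fin n) p} (P? : Decidable P) → (∀ {a} → ¬ P a) → count P? ≡ 0
count-∅ {zero}  P? ¬P = refl
count-∅ {suc n} P? ¬P with P? F.zero
... | yes p = contradiction p ¬P
... | no _  = count-∅ (P? ∘ F.suc) ¬P

count-≡ : ∀ {n} (x : Fin n) → count (F._≟ x) ≡ 1
count-≡ {suc n} F.zero    = cong suc (count-∅ {n} (λ a → F.suc a F.≟ F.zero) λ ())
count-≡ {suc n} (F.suc x) = trans (count-cong _ (F._≟ x) F.suc-injective (cong F.suc)) (count-≡ x)

count≤1 : ∀ {n p} {P : Pred (Fin n) p} (P? : Decidable P) {x} →
          (∀ {a} → P a → a ≡ x) → count P? ≤ 1
count≤1 P? {x} P⊆x = ℕ.≤-trans (count-mono P? (F._≟ x) P⊆x) (ℕ.≤-reflexive (count-≡ x))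

count≡2 : ∀ {n p} {P : Pred (Fin n) p} (P? : Decidable P) {x y} →
          (∀ {a} → P a → a ≡ x ⊎ a ≡ y) → P x → P y → x ≢ y → count P? ≡ 2
count≡2 P? {x} {y} P⊆xy px py x≢y = ℕ.≤-antisym atMost2 atLeast2
  where
  atMost2 : count P? ≤ 2
  atMost2 = ℕ.≤-trans (count-mono P? ((F._≟ x) ∪? (F._≟ y)) P⊆xy)
              (ℕ.≤-trans (count-∪ (F._≟ x) (F._≟ y))
                (ℕ.≤-reflexive (cong₂ _+_ (count-≡ x) (count-≡ y))))
  atLeast2 : 2 ≤ count P?
  atLeast2 = ℕ.≤-trans (ℕ.≤-reflexive (cong suc (sym (count-≡ x))))
               (count-mono-< (F._≟ x) P? (λ { refl → px }) (x≢y ∘ sym) py)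

length-filter-tabulate : ∀ {a p} {A : Set a} {P : Pred A p} (P? : Decidable P) {n} (f : Fin n → A) →
                         length (filter P? (List.tabulate f)) ≡ count (P? ∘ f)
length-filter-tabulate P? {zero}  f = refl
length-filter-tabulate P? {suc n} f with P? (f F.zero)
... | yes _ = cong suc (length-filter-tabulate P? (f ∘ F.suc))
... | no _  = length-filter-tabulate P? (f ∘ F.suc)

length-filter-applyUpTo : ∀ {a p} {A : Set a} {P : Pred A p} (P? : Decidable P) (f : ℕ → A) n →
                          length (filter P? (applyUpTo f n)) ≡ count (λ (i : Fin n) → P? (f (toℕ i)))
length-filter-applyUpTo P? f zero = refl
length-filter-applyUpTo P? f (suc n) with P? (f 0)
... | yes _ = cong suc (length-filter-applyUpTo P? (f ∘ suc) n)
... | no _  = length-filter-applyUpTo P? (f ∘ suc) n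

infix 8 _⟨$⟩_
infixl 10 _⁻¹
infixr 9 _∘ₚ_

_⟨$⟩_ : Perm n → Fin n → Fin n
σ ⟨$⟩ a = lookup (value σ) a

⟨$⟩-injective : (σ : Perm n) → Injective _≡_ _≡_ (σ ⟨$⟩_)
⟨$⟩-injective (_ , [ injective ]) {i} {j} eq = recompute (i F.≟ j) (injective i j eq)

Perm-≡ : {σ τ : Perm n} → (∀ a → σ ⟨$⟩ a ≡ τ ⟨$⟩ a) → σ ≡ τ
Perm-≡ {σ = σ} {τ} σ≗τ = value-injective (begin
  value σ                   ≡⟨ Vec.tabulate∘lookup (value σ) ⟨
  tabulate (σ ⟨$⟩_)          ≡⟨ Vec.tabulate-cong σ≗τ ⟩
  tabulate (τ ⟨$⟩_)          ≡⟨ Vec.tabulate∘lookup (value τ) ⟩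
  value τ                   ∎)
  where open ≡-Reasoning

fromInjective : (f : Fin n → Fin n) → .(Injective _≡_ _≡_ f) → Perm n
fromInjective f f-inj = tabulate f , [ (λ i j eq → f-inj (begin
  f i                ≡⟨ Vec.lookup∘tabulate f i ⟨
  lookup (tabulate f) i ≡⟨ eq ⟩
  lookup (tabulate f) j ≡⟨ Vec.lookup∘tabulate f j ⟩
  f j                ∎)) ]
  where open ≡-Reasoning

injective⇒surjective : (f : Fin n → Fin n) → Injective _≡_ _≡_ f → ∀ b → ∃ λ a → f a ≡ b
injective⇒surjective {suc m} f f-inj b with F.any? (λ a → f a F.≟ b)
... | yes hit  = hit
... | no ¬hit = contradiction (F.injective⇒≤ skipB-injective) ℕ.1+n≰n
  where
  b≢f : ∀ a → b ≢ f a
  b≢f a eq = ¬hit (a , sym eq)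
  skipB : Fin (suc m) → Fin m
  skipB a = F.punchOut (b≢f a)
  skipB-injective : Injective _≡_ _≡_ skipB
  skipB-injective {x} {y} = f-inj ∘ F.punchOut-injective (b≢f x) (b≢f y)

preimage : Perm n → Fin n → Fin n
preimage σ = proj₁ ∘ injective⇒surjective (σ ⟨$⟩_) (⟨$⟩-injective σ)

⟨$⟩-preimage : (σ : Perm n) (b : Fin n) → σ ⟨$⟩ preimage σ b ≡ b
⟨$⟩-preimage σ = proj₂ ∘ injective⇒surjective (σ ⟨$⟩_) (⟨$⟩-injective σ)

_⁻¹ : Perm n → Perm n
σ ⁻¹ = fromInjective (preimage σ) λ {b} {c} eq → begin
  b                    ≡⟨ ⟨$⟩-preimage σ b ⟨
  σ ⟨$⟩ preimage σ b    ≡⟨ cong (σ ⟨$⟩_) eq ⟩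
  σ ⟨$⟩ preimage σ c    ≡⟨ ⟨$⟩-preimage σ c ⟩
  c                    ∎
  where open ≡-Reasoning

inverseʳ : (σ : Perm n) (b : Fin n) → σ ⟨$⟩ (σ ⁻¹ ⟨$⟩ b) ≡ b
inverseʳ σ b = trans (cong (σ ⟨$⟩_) (Vec.lookup∘tabulate (preimage σ) b)) (⟨$⟩-preimage σ b)

inverseˡ : (σ : Perm n) (a : Fin n) → σ ⁻¹ ⟨$⟩ (σ ⟨$⟩ a) ≡ a
inverseˡ σ a = ⟨$⟩-injective σ (inverseʳ σ (σ ⟨$⟩ a))

_∘ₚ_ : Perm n → Perm n → Perm n
σ ∘ₚ τ = fromInjective (λ a → σ ⟨$⟩ (τ ⟨$⟩ a)) (⟨$⟩-injective τ ∘ ⟨$⟩-injective σ)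

∘ₚ-⟨$⟩ : (σ τ : Perm n) (a : Fin n) → σ ∘ₚ τ ⟨$⟩ a ≡ σ ⟨$⟩ (τ ⟨$⟩ a)
∘ₚ-⟨$⟩ σ τ = Vec.lookup∘tabulate (λ a → σ ⟨$⟩ (τ ⟨$⟩ a))

idₚ : Perm n
idₚ = fromInjective id id

∘ₚ⁻¹-⟨$⟩ : (ρ τ : Perm n) (i : Fin n) → ρ ∘ₚ τ ⁻¹ ⟨$⟩ (τ ⟨$⟩ i) ≡ ρ ⟨$⟩ i
∘ₚ⁻¹-⟨$⟩ ρ τ i = trans (∘ₚ-⟨$⟩ ρ (τ ⁻¹) _) (cong (ρ ⟨$⟩_) (inverseˡ τ i))

∘ₚ⁻¹-cancelʳ : (σ τ : Perm n) (a : Fin n) → (σ ∘ₚ τ) ∘ₚ τ ⁻¹ ⟨$⟩ a ≡ σ ⟨$⟩ a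
∘ₚ⁻¹-cancelʳ σ τ a = begin
  (σ ∘ₚ τ) ∘ₚ τ ⁻¹ ⟨$⟩ a      ≡⟨ ∘ₚ-⟨$⟩ (σ ∘ₚ τ) (τ ⁻¹) a ⟩
  σ ∘ₚ τ ⟨$⟩ (τ ⁻¹ ⟨$⟩ a)     ≡⟨ ∘ₚ-⟨$⟩ σ τ _ ⟩
  σ ⟨$⟩ (τ ⟨$⟩ (τ ⁻¹ ⟨$⟩ a))  ≡⟨ cong (σ ⟨$⟩_) (inverseʳ τ a) ⟩
  σ ⟨$⟩ a                    ∎
  where open ≡-Reasoning

opposite-< : ∀ {i j : Fin n} → i F.< j → F.opposite j F.< F.opposite i
opposite-< {n} {i} {j} i<j = begin-strict
  toℕ (F.opposite j)  ≡⟨ F.opposite-prop j ⟩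
  n ∸ suc (toℕ j)     <⟨ ℕ.∸-monoʳ-< (s≤s i<j) (F.toℕ<n j) ⟩
  n ∸ suc (toℕ i)     ≡⟨ F.opposite-prop i ⟨
  toℕ (F.opposite i)  ∎
  where open ℕ.≤-Reasoning

increasing⇒inflationary : ∀ {m n} (f : Fin n → Fin m) → f Preserves F._<_ ⟶ F._<_ → ∀ i → i F.≤ f i
increasing⇒inflationary f f-incr F.zero    = z≤n
increasing⇒inflationary f f-incr (F.suc i) = begin-strict
  toℕ i                  ≤⟨ increasing⇒inflationary (f ∘ F.inject₁) f∘inject₁-incr i ⟩
  toℕ (f (F.inject₁ i))  <⟨ f-incr (F.≤̄⇒inject₁< ℕ.≤-refl) ⟩
  toℕ (f (F.suc i))      ∎
  where
  open ℕ.≤-Reasoning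
  f∘inject₁-incr : (f ∘ F.inject₁) Preserves F._<_ ⟶ F._<_
  f∘inject₁-incr {x} {y} = f-incr ∘ subst₂ ℕ._<_ (sym (F.toℕ-inject₁ x)) (sym (F.toℕ-inject₁ y))

increasing⇒id : (f : Fin n → Fin n) → f Preserves F._<_ ⟶ F._<_ → ∀ i → f i ≡ i
increasing⇒id f f-incr i = F.≤-antisym fi≤i (increasing⇒inflationary f f-incr i)
  where
  f-opp-incr : (F.opposite ∘ f ∘ F.opposite) Preserves F._<_ ⟶ F._<_
  f-opp-incr = opposite-< ∘ f-incr ∘ opposite-<
  opp-i≤opp-fi : F.opposite i F.≤ F.opposite (f i)
  opp-i≤opp-fi = subst (λ x → F.opposite i F.≤ F.opposite (f x)) (F.opposite-involutive i)
                   (increasing⇒inflationary _ f-opp-incr (F.opposite i))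
  -- f i ≤ i is inflationarity of opposite ∘ f ∘ opposite at opposite i.
  fi≤i : f i F.≤ i
  fi≤i = ℕ.≮⇒≥ (λ i<fi → ℕ.<⇒≱ (opposite-< i<fi) opp-i≤opp-fi)

module Sorting {n} (key : Fin n → ℕ) (key-injective : Injective _≡_ _≡_ key) where

  rank : Fin n → Fin n
  rank a = F.fromℕ< (count<n (λ b → key b ℕ.<? key a) (ℕ.<-irrefl refl))

  rank-< : ∀ {a b} → key a < key b → rank a F.< rank b
  rank-< {a} {b} ka<kb = subst₂ ℕ._<_ (sym (F.toℕ-fromℕ< _)) (sym (F.toℕ-fromℕ< _))
    (count-mono-< (λ c → key c ℕ.<? key a) (λ c → key c ℕ.<? key b) (λ kc<ka → ℕ.<-trans kc<ka ka<kb)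
                  (ℕ.<-irrefl refl) ka<kb)

  rank-injective : Injective _≡_ _≡_ rank
  rank-injective {a} {b} ra≡rb with ℕ.<-cmp (key a) (key b)
  ... | tri< ka<kb _ _ = contradiction ra≡rb (F.<⇒≢ (rank-< ka<kb))
  ... | tri≈ _ ka≡kb _ = key-injective ka≡kb
  ... | tri> _ _ kb<ka = contradiction (sym ra≡rb) (F.<⇒≢ (rank-< kb<ka))

  rank-cancel-< : ∀ {a b} → rank a F.< rank b → key a < key b
  rank-cancel-< {a} {b} ra<rb with ℕ.<-cmp (key a) (key b)
  ... | tri< ka<kb _ _ = ka<kb
  ... | tri≈ _ ka≡kb _ = contradiction (cong rank (key-injective ka≡kb)) (F.<⇒≢ ra<rb)
  ... | tri> _ _ kb<ka = contradiction (rank-< kb<ka) (F.<-asym ra<rb)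

  sorting : Perm n
  sorting = fromInjective rank rank-injective ⁻¹

  rank-sorting : ∀ i → rank (sorting ⟨$⟩ i) ≡ i
  rank-sorting i = trans (sym (Vec.lookup∘tabulate rank _)) (inverseʳ (fromInjective rank rank-injective) i)

  sorting⁻¹≗rank : ∀ a → sorting ⁻¹ ⟨$⟩ a ≡ rank a
  sorting⁻¹≗rank a = ⟨$⟩-injective sorting (begin
    sorting ⟨$⟩ (sorting ⁻¹ ⟨$⟩ a)  ≡⟨ inverseʳ sorting a ⟩
    a                             ≡⟨ rank-injective (rank-sorting (rank a)) ⟨
    sorting ⟨$⟩ rank a             ∎)
    where open ≡-Reasoning

  sorting-increasing : (key ∘ (sorting ⟨$⟩_)) Preserves F._<_ ⟶ ℕ._<_
  sorting-increasing {i} {j} i<j =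
    rank-cancel-< (subst₂ F._<_ (sym (rank-sorting i)) (sym (rank-sorting j)) i<j)

  sorting-unique : (τ : Perm n) → (key ∘ (τ ⟨$⟩_)) Preserves F._<_ ⟶ ℕ._<_ → τ ≡ sorting
  sorting-unique τ τ-incr = Perm-≡ λ i → rank-injective (begin
    rank (τ ⟨$⟩ i)       ≡⟨ increasing⇒id (rank ∘ (τ ⟨$⟩_)) (rank-< ∘ τ-incr) i ⟩
    i                   ≡⟨ rank-sorting i ⟨
    rank (sorting ⟨$⟩ i) ∎)
    where open ≡-Reasoning

Choices : ∀ {n p} → Pred (Fin n) p → Set p
Choices {n} P = [ c ∈ Vec Bool n ∣ (∀ v → lookup c v ≡ true → P v) ]

module _ {n p} {P : Pred (Fin (suc n)) p} where

  Choices-cons : P F.zero → Choices P ↔ (Bool × Choices (P ∘ F.suc))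
  Choices-cons p₀ = mk↔ₛ′ uncons cons (λ _ → refl) cons∘uncons
    where
    uncons : Choices P → Bool × Choices (P ∘ F.suc)
    uncons (b Vec.∷ c , [ c⊆P ]) = b , (c , [ c⊆P ∘ F.suc ])
    cons : Bool × Choices (P ∘ F.suc) → Choices P
    cons (b , (c , [ c⊆P ])) = b Vec.∷ c , [ (λ { F.zero _ → p₀ ; (F.suc v) → c⊆P v }) ]
    cons∘uncons : ∀ c → cons (uncons c) ≡ c
    cons∘uncons (_ Vec.∷ _ , _) = refl

  Choices-tail : ¬ P F.zero → Choices P ↔ Choices (P ∘ F.suc)
  Choices-tail ¬p₀ = mk↔ₛ′ tail cons (λ _ → refl) cons∘tail
    where
    tail : Choices P → Choices (P ∘ F.suc)
    tail (_ Vec.∷ c , [ c⊆P ]) = c , [ c⊆P ∘ F.suc ]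
    cons : Choices (P ∘ F.suc) → Choices P
    cons (c , [ c⊆P ]) = false Vec.∷ c , [ (λ { F.zero () ; (F.suc v) → c⊆P v }) ]
    cons∘tail : ∀ c → cons (tail c) ≡ c
    cons∘tail (false Vec.∷ _ , _)       = refl
    cons∘tail (true  Vec.∷ _ , [ c⊆P ]) = ⊥-elim-irr (¬p₀ (c⊆P F.zero refl))

Choices↔Fin : ∀ {n p} {P : Pred (Fin n) p} (P? : Decidable P) → Choices P ↔ Fin (2 ^ count P?)
Choices↔Fin {zero}  P? = mk↔ₛ′ (λ _ → F.zero) (λ _ → Vec.[] , [ (λ ()) ])
                               (λ { F.zero → refl ; (F.suc ()) }) (λ { (Vec.[] , _) → refl })
Choices↔Fin {suc n} {P = P} P? with P? F.zero
... | yes p₀ = begin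
  Choices P                               ↔⟨ Choices-cons p₀ ⟩
  (Bool × Choices (P ∘ F.suc))            ↔⟨ ↔-sym F.2↔Bool ×-↔ Choices↔Fin (P? ∘ F.suc) ⟩
  (Fin 2 × Fin (2 ^ count (P? ∘ F.suc)))  ↔⟨ F.*↔× ⟨
  Fin (2 ^ suc (count (P? ∘ F.suc)))      ∎
  where open EquationalReasoning
... | no ¬p₀ = ↔-trans (Choices-tail ¬p₀) (Choices↔Fin (P? ∘ F.suc))

Precedes : Perm n → Fin n → Fin n → Set
Precedes τ x y = τ ⁻¹ ⟨$⟩ x F.< τ ⁻¹ ⟨$⟩ y

Precedes-⟨$⟩⁺ : (τ : Perm n) {i j : Fin n} → i F.< j → Precedes τ (τ ⟨$⟩ i) (τ ⟨$⟩ j)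
Precedes-⟨$⟩⁺ τ {i} {j} = subst₂ F._<_ (sym (inverseˡ τ i)) (sym (inverseˡ τ j))

Precedes-⟨$⟩⁻ : (τ : Perm n) {i j : Fin n} → Precedes τ (τ ⟨$⟩ i) (τ ⟨$⟩ j) → i F.< j
Precedes-⟨$⟩⁻ τ {i} {j} = subst₂ F._<_ (inverseˡ τ i) (inverseˡ τ j)

MonotoneOrderings : (Fin n → ℕ) → Set
MonotoneOrderings {n} f = [ τ ∈ Perm n ∣ (f ∘ (τ ⟨$⟩_)) Preserves F._≤_ ⟶ ℕ._≤_ ]

canon : Perm n → S3 n
canon σ = idₚ , σ

module Levels {n} (σ : Perm n) where

  level : Fin n → ℕ
  level a = toℕ a ⊔ toℕ (σ ⟨$⟩ a)

  Top : Pred (Fin n) 0ℓ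
  Top a = σ ⟨$⟩ a F.≤ a

  level-top : ∀ {a} → Top a → level a ≡ toℕ a
  level-top = ℕ.m≥n⇒m⊔n≡m

  level-nontop : ∀ {a} → ¬ Top a → level a ≡ toℕ (σ ⟨$⟩ a)
  level-nontop ¬top = ℕ.m≤n⇒m⊔n≡n (ℕ.<⇒≤ (ℕ.≰⇒> ¬top))

  Partner : Fin n → Fin n → Set
  Partner t p = Top t × σ ⟨$⟩ p ≡ t × p F.< t

  sameLevel : ∀ {a b} → a ≢ b → level a ≡ level b → Partner a b ⊎ Partner b a
  sameLevel {a} {b} a≢b la≡lb with σ ⟨$⟩ a F.≤? a | σ ⟨$⟩ b F.≤? b
  ... | yes ta | yes tb = contradiction (F.toℕ-injective (begin
      toℕ a    ≡⟨ level-top ta ⟨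
      level a  ≡⟨ la≡lb ⟩
      level b  ≡⟨ level-top tb ⟩
      toℕ b    ∎)) a≢b
    where open ≡-Reasoning
  ... | yes ta | no ¬tb = inj₁ (ta , σb≡a , subst (b F.<_) σb≡a (ℕ.≰⇒> ¬tb))
    where
    σb≡a : σ ⟨$⟩ b ≡ a
    σb≡a = F.toℕ-injective (trans (sym (level-nontop ¬tb)) (trans (sym la≡lb) (level-top ta)))
  ... | no ¬ta | yes tb = inj₂ (tb , σa≡b , subst (a F.<_) σa≡b (ℕ.≰⇒> ¬ta))
    where
    σa≡b : σ ⟨$⟩ a ≡ b
    σa≡b = F.toℕ-injective (trans (sym (level-nontop ¬ta)) (trans la≡lb (level-top tb)))
  ... | no ¬ta | no ¬tb = contradiction (⟨$⟩-injective σ (F.toℕ-injective (begin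
      toℕ (σ ⟨$⟩ a)  ≡⟨ level-nontop ¬ta ⟨
      level a       ≡⟨ la≡lb ⟩
      level b       ≡⟨ level-nontop ¬tb ⟩
      toℕ (σ ⟨$⟩ b)  ∎))) a≢b
    where open ≡-Reasoning

  partner-nontop : ∀ {t p} → Partner t p → ¬ Top p
  partner-nontop {p = p} (_ , σp≡t , p<t) = ℕ.<⇒≱ (subst (p F.<_) (sym σp≡t) p<t)

  partner-level : ∀ {t p} → Partner t p → level p ≡ level t
  partner-level {t} {p} partner@(top , σp≡t , _) = begin
    level p        ≡⟨ level-nontop (partner-nontop partner) ⟩
    toℕ (σ ⟨$⟩ p)   ≡⟨ cong toℕ σp≡t ⟩
    toℕ t          ≡⟨ level-top top ⟨
    level t        ∎
    where open ≡-Reasoning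

  Doubled : Pred (Fin n) 0ℓ
  Doubled v = Top v × σ ⁻¹ ⟨$⟩ v F.< v

  doubled? : Decidable Doubled
  doubled? v = (σ ⟨$⟩ v F.≤? v) ×-dec (σ ⁻¹ ⟨$⟩ v F.<? v)

  partner-preimage : ∀ {t p} → Partner t p → σ ⁻¹ ⟨$⟩ t ≡ p
  partner-preimage {p = p} (_ , σp≡t , _) = trans (cong (σ ⁻¹ ⟨$⟩_) (sym σp≡t)) (inverseˡ σ p)

  partner⇒doubled : ∀ {t p} → Partner t p → Doubled t
  partner⇒doubled {t} partner@(top , _ , p<t) = top , subst (F._< t) (sym (partner-preimage partner)) p<t

  doubled⇒partner : ∀ {v} → Doubled v → Partner v (σ ⁻¹ ⟨$⟩ v)
  doubled⇒partner {v} (top , p<v) = top , inverseʳ σ v , p<v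

  levelFibre-⊆ : ∀ {a v} → level a ≡ toℕ v → a ≡ v ⊎ a ≡ σ ⁻¹ ⟨$⟩ v
  levelFibre-⊆ {a} {v} la≡v with σ ⟨$⟩ a F.≤? a
  ... | yes top = inj₁ (F.toℕ-injective (trans (sym (level-top top)) la≡v))
  ... | no ¬top = inj₂ (begin
    a                   ≡⟨ inverseˡ σ a ⟨
    σ ⁻¹ ⟨$⟩ (σ ⟨$⟩ a)   ≡⟨ cong (σ ⁻¹ ⟨$⟩_) (F.toℕ-injective (trans (sym (level-nontop ¬top)) la≡v)) ⟩
    σ ⁻¹ ⟨$⟩ v           ∎)
    where open ≡-Reasoning

  levelCount : ℕ → ℕ
  levelCount ℓ = count (λ a → level a ℕ.≟ ℓ)

  doubled⇒levelCount≡2 : ∀ {v} → Doubled v → levelCount (toℕ v) ≡ 2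
  doubled⇒levelCount≡2 {v} doubled@(top , p<v) =
    count≡2 (λ a → level a ℕ.≟ toℕ v) levelFibre-⊆ (level-top top)
      (trans (partner-level (doubled⇒partner doubled)) (level-top top))
      (λ v≡p → F.<-irrefl (sym v≡p) p<v)

  levelCount≡2⇒doubled : ∀ {v} → levelCount (toℕ v) ≡ 2 → Doubled v
  levelCount≡2⇒doubled {v} count≡2 with σ ⟨$⟩ v F.≤? v | σ ⁻¹ ⟨$⟩ v F.<? v
  ... | yes top | yes p<v = top , p<v
  ... | no ¬top | _       = contradiction count≡2 (ℕ.<⇒≢ (s≤s (count≤1 _ onlyPreimage)))
    where
    onlyPreimage : ∀ {a} → level a ≡ toℕ v → a ≡ σ ⁻¹ ⟨$⟩ v
    onlyPreimage la≡v with levelFibre-⊆ la≡v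
    ... | inj₁ refl = contradiction (trans (sym la≡v) (level-nontop ¬top)) (ℕ.<⇒≢ (ℕ.≰⇒> ¬top))
    ... | inj₂ a≡p  = a≡p
  ... | yes top | no ¬p<v = contradiction count≡2 (ℕ.<⇒≢ (s≤s (count≤1 _ onlyV)))
    where
    onlyV : ∀ {a} → level a ≡ toℕ v → a ≡ v
    onlyV la≡v with levelFibre-⊆ la≡v
    ... | inj₁ a≡v  = a≡v
    ... | inj₂ refl = F.≤-antisym (subst (toℕ (σ ⁻¹ ⟨$⟩ v) ≤_) la≡v (ℕ.m≤m⊔n _ _)) (ℕ.≮⇒≥ ¬p<v)

  module Keys (c : Fin n → Bool) where

    -- c t = true puts the partner σ⁻¹ t before the top t.
    tieBreak : Fin n → Bool
    tieBreak a = if does (σ ⟨$⟩ a F.≤? a) then c a else not (c (σ ⟨$⟩ a))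

    key : Fin n → ℕ
    key a = 2 * level a + (if tieBreak a then 1 else 0)

    tieBreak-partner : ∀ {t p} → Partner t p → tieBreak t ≡ c t × tieBreak p ≡ not (c t)
    tieBreak-partner {t} {p} partner@(top , σp≡t , _)
      rewrite dec-true (σ ⟨$⟩ t F.≤? t) top
            | dec-false (σ ⟨$⟩ p F.≤? p) (partner-nontop partner)
            | σp≡t = refl , refl

    key-level-< : ∀ {a b} → level a < level b → key a < key b
    key-level-< {a} {b} la<lb = begin-strict
      2 * level a + bit a       ≤⟨ ℕ.+-monoʳ-≤ (2 * level a) (bit≤1 (tieBreak a)) ⟩
      2 * level a + 1           <⟨ ℕ.+-monoʳ-< (2 * level a) (ℕ.n<1+n 1) ⟩
      2 * level a + 2           ≡⟨ trans (ℕ.+-comm (2 * level a) 2) (sym (ℕ.*-suc 2 (level a))) ⟩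
      2 * suc (level a)         ≤⟨ ℕ.*-monoʳ-≤ 2 la<lb ⟩
      2 * level b               ≤⟨ ℕ.m≤m+n (2 * level b) (bit b) ⟩
      2 * level b + bit b       ∎
      where
      open ℕ.≤-Reasoning
      bit : Fin n → ℕ
      bit x = if tieBreak x then 1 else 0
      bit≤1 : ∀ b → (if b then 1 else 0) ≤ 1
      bit≤1 true  = ℕ.≤-refl
      bit≤1 false = z≤n

    key-tieBreak-< : ∀ {a b} → level a ≡ level b →
                     tieBreak a ≡ false → tieBreak b ≡ true → key a < key b
    key-tieBreak-< {a} {b} la≡lb tba tbb rewrite tba | tbb | la≡lb = ℕ.+-monoʳ-< (2 * level b) (ℕ.n<1+n 0)

    key-partner-true : ∀ {t p} → Partner t p → c t ≡ true → key p < key t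
    key-partner-true partner ct with tieBreak-partner partner
    ... | tbt , tbp = key-tieBreak-< (partner-level partner) (trans tbp (cong not ct)) (trans tbt ct)

    key-partner-false : ∀ {t p} → Partner t p → c t ≡ false → key t < key p
    key-partner-false partner cf with tieBreak-partner partner
    ... | tbt , tbp = key-tieBreak-< (sym (partner-level partner)) (trans tbt cf) (trans tbp (cong not cf))

    partner-key-≢ : ∀ {t p} → Partner t p → key t ≢ key p
    partner-key-≢ {t} {p} partner = by-choice (c t) refl
      where
      by-choice : ∀ b → c t ≡ b → key t ≢ key p
      by-choice true  ct = ≢-sym (ℕ.<⇒≢ (key-partner-true partner ct))
      by-choice false ct = ℕ.<⇒≢ (key-partner-false partner ct)

    key-injective : Injective _≡_ _≡_ key
    key-injective {a} {b} ka≡kb with ℕ.<-cmp (level a) (level b) | a F.≟ b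
    ... | _              | yes a≡b = a≡b
    ... | tri< la<lb _ _ | no _    = contradiction ka≡kb (ℕ.<⇒≢ (key-level-< la<lb))
    ... | tri> _ _ lb<la | no _    = contradiction (sym ka≡kb) (ℕ.<⇒≢ (key-level-< lb<la))
    ... | tri≈ _ la≡lb _ | no a≢b  with sameLevel a≢b la≡lb
    ...   | inj₁ partner = contradiction ka≡kb (partner-key-≢ partner)
    ...   | inj₂ partner = contradiction (sym ka≡kb) (partner-key-≢ partner)

    key-≤⇒level-≤ : ∀ {a b} → key a ≤ key b → level a ≤ level b
    key-≤⇒level-≤ ka≤kb = ℕ.≮⇒≥ (λ lb<la → ℕ.<⇒≱ (key-level-< lb<la) ka≤kb)

  PartnerFirst : Perm n → Pred (Fin n) 0ℓ
  PartnerFirst τ v = Doubled v × Precedes τ (σ ⁻¹ ⟨$⟩ v) v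

  partnerFirst? : (τ : Perm n) → Decidable (PartnerFirst τ)
  partnerFirst? τ v = doubled? v ×-dec (_ F.<? _)

  partnerFirst⁺ : ∀ τ {i j} → Partner (τ ⟨$⟩ j) (τ ⟨$⟩ i) → i F.< j → PartnerFirst τ (τ ⟨$⟩ j)
  partnerFirst⁺ τ partner i<j = partner⇒doubled partner ,
    subst (λ p → Precedes τ p _) (sym (partner-preimage partner)) (Precedes-⟨$⟩⁺ τ i<j)

  partnerFirst⁻ : ∀ τ {i j} → Partner (τ ⟨$⟩ j) (τ ⟨$⟩ i) → PartnerFirst τ (τ ⟨$⟩ j) → i F.< j
  partnerFirst⁻ τ partner (_ , p-first) =
    Precedes-⟨$⟩⁻ τ (subst (λ p → Precedes τ p _) (partner-preimage partner) p-first)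

  fromChoice : Choices Doubled → MonotoneOrderings level
  fromChoice (c , _) = sorting , [ (λ {i} {j} i≤j → key-≤⇒level-≤ (sorted i≤j)) ]
    where
    open Keys (lookup c)
    open Sorting key key-injective
    sorted : ∀ {i j} → i F.≤ j → key (sorting ⟨$⟩ i) ≤ key (sorting ⟨$⟩ j)
    sorted {i} {j} i≤j with ℕ.m≤n⇒m<n∨m≡n i≤j
    ... | inj₁ i<j = ℕ.<⇒≤ (sorting-increasing i<j)
    ... | inj₂ i≡j = ℕ.≤-reflexive (cong (key ∘ (sorting ⟨$⟩_)) (F.toℕ-injective i≡j))

  toChoice : MonotoneOrderings level → Choices Doubled
  toChoice (τ , _) = tabulate choose , [ chosen⇒doubled ]
    where
    choose : Fin n → Bool
    choose = does ∘ partnerFirst? τ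
    chosen⇒doubled : ∀ v → lookup (tabulate choose) v ≡ true → Doubled v
    chosen⇒doubled v chosen =
      proj₁ (does-true (partnerFirst? τ v) (trans (sym (Vec.lookup∘tabulate choose v)) chosen))

  toChoice∘fromChoice : ∀ c → toChoice (fromChoice c) ≡ c
  toChoice∘fromChoice (c , [ c⊆D ]) =
    value-injective (trans (Vec.tabulate-cong (λ v → chosen (lookup c v) refl)) (Vec.tabulate∘lookup c))
    where
    open Keys (lookup c)
    open Sorting key key-injective
    rank-<⇒precedes : ∀ {x y} → rank x F.< rank y → Precedes sorting x y
    rank-<⇒precedes {x} {y} = subst₂ F._<_ (sym (sorting⁻¹≗rank x)) (sym (sorting⁻¹≗rank y))
    precedes⇒rank-< : ∀ {x y} → Precedes sorting x y → rank x F.< rank y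
    precedes⇒rank-< {x} {y} = subst₂ F._<_ (sorting⁻¹≗rank x) (sorting⁻¹≗rank y)
    chosen : ∀ {v} b → lookup c v ≡ b → does (partnerFirst? sorting v) ≡ b
    chosen {v} true  cv = dec-true (partnerFirst? sorting v)
      (doubled , rank-<⇒precedes (rank-< (key-partner-true (doubled⇒partner doubled) cv)))
      where
      doubled : Doubled v
      doubled = recompute (doubled? v) (c⊆D v cv)
    chosen {v} false cv = dec-false (partnerFirst? sorting v) λ (doubled , p-first) →
      F.<-asym (rank-< (key-partner-false (doubled⇒partner doubled) cv))
               (precedes⇒rank-< p-first)

  fromChoice∘toChoice : ∀ τ → fromChoice (toChoice τ) ≡ τ
  fromChoice∘toChoice (τ , [ monotone ]) = value-injective (sym (sorting-unique τ key∘τ-increasing))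
    where
    choose : Fin n → Bool
    choose = lookup (tabulate (does ∘ partnerFirst? τ))
    choose-partnerFirst : ∀ v → choose v ≡ does (partnerFirst? τ v)
    choose-partnerFirst = Vec.lookup∘tabulate (does ∘ partnerFirst? τ)
    open Keys choose
    open Sorting key key-injective
    key∘τ-increasing : (key ∘ (τ ⟨$⟩_)) Preserves F._<_ ⟶ ℕ._<_
    key∘τ-increasing {i} {j} i<j
      with ℕ.m≤n⇒m<n∨m≡n (recompute (_ ℕ.≤? _) (monotone (ℕ.<⇒≤ i<j)))
    ... | inj₁ level< = key-level-< level<
    ... | inj₂ level≡ with sameLevel (F.<⇒≢ i<j ∘ ⟨$⟩-injective τ) level≡
    ...   | inj₁ partner = key-partner-false partner (trans (choose-partnerFirst (τ ⟨$⟩ i))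
              (dec-false (partnerFirst? τ _) (F.<-asym i<j ∘ partnerFirst⁻ τ partner)))
    ...   | inj₂ partner = key-partner-true partner (trans (choose-partnerFirst (τ ⟨$⟩ j))
              (dec-true (partnerFirst? τ _) (partnerFirst⁺ τ partner i<j)))

  orderings↔choices : MonotoneOrderings level ↔ Choices Doubled
  orderings↔choices = mk↔ₛ′ toChoice fromChoice toChoice∘fromChoice fromChoice∘toChoice

  lev-canon : ∀ a → lev (canon σ) a ≡ level a
  lev-canon a = cong (λ x → toℕ x ⊔ toℕ (σ ⟨$⟩ a)) (Vec.lookup∘tabulate id a)

  colsAtLevel-canon : ∀ ℓ → colsAtLevel (canon σ) ℓ ≡ levelCount ℓ
  colsAtLevel-canon ℓ = trans (length-filter-tabulate (λ a → lev (canon σ) a ℕ.≟ ℓ) id)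
    (count-cong (λ a → lev (canon σ) a ℕ.≟ ℓ) (λ a → level a ℕ.≟ ℓ)
                (trans (sym (lev-canon _))) (trans (lev-canon _)))

  doubledLevels-canon : doubledLevels (canon σ) ≡ count doubled?
  doubledLevels-canon = trans (length-filter-applyUpTo (λ ℓ → colsAtLevel (canon σ) ℓ ℕ.≟ 2) id n)
    (count-cong (λ v → colsAtLevel (canon σ) (toℕ v) ℕ.≟ 2) doubled?
      (λ cols≡2 → levelCount≡2⇒doubled (trans (sym (colsAtLevel-canon _)) cols≡2))
      (λ doubled → trans (colsAtLevel-canon _) (doubled⇒levelCount≡2 doubled)))

lev-∘ₚ : (σ τ : Perm n) (i : Fin n) → lev (τ , σ ∘ₚ τ) i ≡ Levels.level σ (τ ⟨$⟩ i)
lev-∘ₚ σ τ i = cong (λ x → toℕ (τ ⟨$⟩ i) ⊔ toℕ x) (∘ₚ-⟨$⟩ σ τ i)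

lev-∘ₚ⁻¹ : (τ ρ : Perm n) (i : Fin n) → lev (τ , ρ) i ≡ Levels.level (ρ ∘ₚ τ ⁻¹) (τ ⟨$⟩ i)
lev-∘ₚ⁻¹ τ ρ i = cong (λ x → toℕ (τ ⟨$⟩ i) ⊔ toℕ x) (sym (∘ₚ⁻¹-⟨$⟩ ρ τ i))

WISet↔orderings : WISet n ↔ Σ (Perm n) (MonotoneOrderings ∘ Levels.level)
WISet↔orderings {n} = mk↔ₛ′ to from to∘from from∘to
  where
  to : WISet n → Σ (Perm n) (MonotoneOrderings ∘ Levels.level)
  to ((τ , ρ) , [ increasing ]) = ρ ∘ₚ τ ⁻¹ , (τ , [ (λ {i} {j} i≤j →
    subst₂ _≤_ (lev-∘ₚ⁻¹ τ ρ i) (lev-∘ₚ⁻¹ τ ρ j) (increasing i j i≤j)) ])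

  from : Σ (Perm n) (MonotoneOrderings ∘ Levels.level) → WISet n
  from (σ , (τ , [ monotone ])) = (τ , σ ∘ₚ τ) , [ (λ i j i≤j →
    subst₂ _≤_ (sym (lev-∘ₚ σ τ i)) (sym (lev-∘ₚ σ τ j)) (monotone i≤j)) ]

  to∘from : ∀ x → to (from x) ≡ x
  to∘from (σ , (τ , _)) = ,-cong (Perm-≡ (∘ₚ⁻¹-cancelʳ σ τ)) refl
    where
    ,-cong : ∀ {σ σ′} {τ : MonotoneOrderings (Levels.level σ)}
               {τ′ : MonotoneOrderings (Levels.level σ′)} →
             σ ≡ σ′ → value τ ≡ value τ′ → (σ , τ) ≡ (σ′ , τ′)
    ,-cong {σ} refl τ≡τ′ = cong (σ ,_) (value-injective τ≡τ′)

  from∘to : ∀ Π → from (to Π) ≡ Π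
  from∘to ((τ , ρ) , _) = value-injective (cong (τ ,_) (Perm-≡ λ i →
    trans (∘ₚ-⟨$⟩ (ρ ∘ₚ τ ⁻¹) τ i) (∘ₚ⁻¹-⟨$⟩ ρ τ i)))

doubledCount : Perm n → Fin (suc n)
doubledCount σ = F.fromℕ< (s≤s (count≤n (Levels.doubled? σ)))

toℕ-doubledCount : (σ : Perm n) → toℕ (doubledCount σ) ≡ doubledLevels (canon σ)
toℕ-doubledCount σ = trans (F.toℕ-fromℕ< _) (sym (Levels.doubledLevels-canon σ))

orderings↔Fin : (σ : Perm n) → MonotoneOrderings (Levels.level σ) ↔ Fin (2 ^ toℕ (doubledCount σ))
orderings↔Fin σ = ↔-trans (orderings↔choices) (↔-trans (Choices↔Fin doubled?)
                    (≡⇒ (cong (λ m → Fin (2 ^ m)) (sym (F.toℕ-fromℕ< (s≤s (count≤n doubled?)))))))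
  where open Levels σ

canonical : (Π : S3 n) → .(Canonical Π) → canon (proj₂ Π) ≡ Π
canonical {n} (π₂ , σ) π₂≡id =
  cong (_, σ) (value-injective (sym (recompute (Vec.≡-dec F._≟_ (value π₂) (idWord n)) π₂≡id)))

doubledCount-fibre↔RSet : (k : Fin (suc n)) → Σ (Perm n) (λ σ → doubledCount σ ≡ k) ↔ RSet n (toℕ k)
doubledCount-fibre↔RSet {n} k = mk↔ₛ′ to from to∘from from∘to
  where
  to : Σ (Perm n) (λ σ → doubledCount σ ≡ k) → RSet n (toℕ k)
  to (σ , count≡k) = canon σ , [ (refl , trans (sym (toℕ-doubledCount σ)) (cong toℕ count≡k)) ]

  from : RSet n (toℕ k) → Σ (Perm n) (λ σ → doubledCount σ ≡ k)
  from (Π , [ Π∈R ]) = proj₂ Π , F.toℕ-injective (begin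
    toℕ (doubledCount (proj₂ Π))    ≡⟨ toℕ-doubledCount (proj₂ Π) ⟩
    doubledLevels (canon (proj₂ Π)) ≡⟨ cong doubledLevels (canonical Π (proj₁ Π∈R)) ⟩
    doubledLevels Π                 ≡⟨ recompute (doubledLevels Π ℕ.≟ toℕ k) (proj₂ Π∈R) ⟩
    toℕ k                           ∎)
    where open ≡-Reasoning

  to∘from : ∀ Π → to (from Π) ≡ Π
  to∘from (Π , [ Π∈R ]) = value-injective (canonical Π (proj₁ Π∈R))

  from∘to : ∀ x → from (to x) ≡ x
  from∘to (σ , _) = cong (σ ,_) (Decidable⇒UIP.≡-irrelevant F._≟_ _ _)

Σ-fibres : ∀ {a b f} {A : Set a} {B : Set b} (F : B → Set f) (h : A → B) →
           Σ A (F ∘ h) ↔ Σ B (λ y → F y × Σ A (λ x → h x ≡ y))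
Σ-fibres F h = mk↔ₛ′ (λ (x , z) → h x , z , x , refl)
                     (λ (_ , z , x , hx≡y) → x , subst F (sym hx≡y) z)
                     (λ { (_ , _ , _ , refl) → refl })
                     (λ _ → refl)

Σ-Fin-suc : ∀ {m b} (B : Fin (suc m) → Set b) → Σ (Fin (suc m)) B ↔ (B F.zero ⊎ Σ (Fin m) (B ∘ F.suc))
Σ-Fin-suc B = mk↔ₛ′ (λ { (F.zero , z) → inj₁ z ; (F.suc k , z) → inj₂ (k , z) })
                    (λ { (inj₁ z) → F.zero , z ; (inj₂ (k , z)) → F.suc k , z })
                    (λ { (inj₁ _) → refl ; (inj₂ _) → refl })
                    (λ { (F.zero , _) → refl ; (F.suc _ , _) → refl })

Σ-Fin↔sum : ∀ m (f g : ℕ → ℕ) →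
            Σ (Fin m) (λ k → Fin (f (g (toℕ k)))) ↔ Fin (sum (List.map f (applyUpTo g m)))
Σ-Fin↔sum zero    f g = mk↔ₛ′ (λ ()) (λ ()) (λ ()) (λ ())
Σ-Fin↔sum (suc m) f g = begin
  Σ (Fin (suc m)) (λ k → Fin (f (g (toℕ k))))                    ↔⟨ Σ-Fin-suc _ ⟩
  (Fin (f (g 0)) ⊎ Σ (Fin m) (λ k → Fin (f (g (suc (toℕ k))))))   ↔⟨ ↔-refl ⊎-↔ Σ-Fin↔sum m f (g ∘ suc) ⟩
  (Fin (f (g 0)) ⊎ Fin (sum (List.map f (applyUpTo (g ∘ suc) m)))) ↔⟨ F.+↔⊎ ⟨
  Fin (sum (List.map f (applyUpTo g (suc m))))                    ∎
  where open EquationalReasoning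

theorem3p8 : (n WI : ℕ) (R : ℕ → ℕ)
    → (WISet n ↔ Fin WI)
    → (∀ k → RSet n k ↔ Fin (R k))
    → WI ≡ sumTo n (λ k → 2 ^ k * R k)
theorem3p8 n WI R WI↔ R↔ = ↔⇒≡ (begin
  Fin WI
    ↔⟨ WI↔ ⟨
  WISet n
    ↔⟨ WISet↔orderings ⟩
  Σ (Perm n) (MonotoneOrderings ∘ Levels.level)
    ↔⟨ Σ-↔ ↔-refl (λ {σ} → orderings↔Fin σ) ⟩
  Σ (Perm n) (λ σ → Fin (2 ^ toℕ (doubledCount σ)))
    ↔⟨ Σ-fibres (λ k → Fin (2 ^ toℕ k)) doubledCount ⟩
  Σ (Fin (suc n)) (λ k → Fin (2 ^ toℕ k) × Σ (Perm n) (λ σ → doubledCount σ ≡ k))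
    ↔⟨ Σ-↔ ↔-refl (λ {k} → ↔-refl ×-↔ ↔-trans (doubledCount-fibre↔RSet k) (R↔ (toℕ k))) ⟩
  Σ (Fin (suc n)) (λ k → Fin (2 ^ toℕ k) × Fin (R (toℕ k)))
    ↔⟨ Σ-↔ ↔-refl F.*↔× ⟨
  Σ (Fin (suc n)) (λ k → Fin (2 ^ toℕ k * R (toℕ k)))
    ↔⟨ Σ-Fin↔sum (suc n) (λ k → 2 ^ k * R k) id ⟩
  Fin (sumTo n (λ k → 2 ^ k * R k))
    ∎)
  where open EquationalReasoning
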